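{- Let $G\simeq C_2^3$ and let $f$ be an automorphism of $\mathcal{P}_{0}(G)$ with trivial pullback. Then $f$ is the identity.
   Context: For an additively written finite abelian group $G$, $\mathcal{P}_{0}(G)$ denotes the reduced power monoid of $G$: the set of all subsets of $G$ containing $0$, with setwise addition $X+Y=\{x+y : x\in X, y\in Y\}$ and identity $\{0\}$. An automorphism $f$ of $\mathcal{P}_{0}(G)$ has trivial pullback if $f(\{0,a\})=\{0,a\}$ for every $a\in G$. $C_2$ is the cyclic group of order $2$. -}

module Defs where

open import Data.Bool using (Bool; true; false; _∧_; _∨_; _xor_; _≟_)
open import Data.Nat using (ℕ; zero; suc)
open import Data.Vec using (Vec; []; _∷_; zipWith; replicate)
open import Data.Vec.Properties using (≡-dec)
open import Data.List using (List; []; _∷_; map; _++_; cartesianProduct)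
open import Data.Bool.ListAction using (any)
open import Data.Product using (_×_; _,_; Σ)
open import Relation.Nullary.Decidable using (⌊_⌋)
open import Relation.Binary.PropositionalEquality using (_≡_; refl; cong)
open import Relation.Nullary using (Dec; yes; no)
open import Data.Empty using (⊥-elim)

C₂^ : ℕ → Set
C₂^ n = Vec Bool n

_⊞_ : ∀ {n} → C₂^ n → C₂^ n → C₂^ n
_⊞_ = zipWith _xor_

𝟘 : ∀ {n} → C₂^ n
𝟘 = replicate _ false

_≟ᴳ_ : ∀ {n} (x y : C₂^ n) → Dec (x ≡ y)
_≟ᴳ_ = ≡-dec _≟_

elems : ∀ n → List (C₂^ n)
elems zero = [] ∷ []
elems (suc n) = map (false ∷_) (elems n) ++ map (true ∷_) (elems n)

Subset : ℕ → Set
Subset n = C₂^ n → Bool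

_+ˢ_ : ∀ {n} → Subset n → Subset n → Subset n
_+ˢ_ {n} X Y z =
  any (λ { (x , y) → X x ∧ Y y ∧ ⌊ (x ⊞ y) ≟ᴳ z ⌋ })
      (cartesianProduct (elems n) (elems n))

record P₀ (n : ℕ) : Set where
  constructor mkP₀
  field
    set  : Subset n
    has0 : set 𝟘 ≡ true
open P₀ public

_≐_ : ∀ {n} → P₀ n → P₀ n → Set
_≐_ {n} X Y = (g : C₂^ n) → set X g ≡ set Y g

elems-head : ∀ n → Σ (List (C₂^ n)) (λ r → elems n ≡ 𝟘 ∷ r)
elems-head zero = [] , refl
elems-head (suc n) with elems n | elems-head n
... | .(𝟘 ∷ r) | r , refl = _ , refl

𝟘⊞𝟘 : ∀ n → (𝟘 {n} ⊞ 𝟘) ≡ 𝟘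
𝟘⊞𝟘 zero = refl
𝟘⊞𝟘 (suc n) = cong (false ∷_) (𝟘⊞𝟘 n)

0∈+ˢ : ∀ {n} (X Y : Subset n) → X 𝟘 ≡ true → Y 𝟘 ≡ true → (X +ˢ Y) 𝟘 ≡ true
0∈+ˢ {n} X Y hx hy with elems n | elems-head n
... | .(𝟘 ∷ r) | r , refl with (𝟘 {n} ⊞ 𝟘) ≟ᴳ 𝟘
... | no ¬p = ⊥-elim (¬p (𝟘⊞𝟘 n))
... | yes _ rewrite hx | hy = refl

_⊕_ : ∀ {n} → P₀ n → P₀ n → P₀ n
X ⊕ Y = mkP₀ (set X +ˢ set Y) (0∈+ˢ (set X) (set Y) (has0 X) (has0 Y))

pair0 : ∀ {n} → C₂^ n → P₀ n
pair0 {n} a = mkP₀ (λ g → ⌊ g ≟ᴳ 𝟘 ⌋ ∨ ⌊ g ≟ᴳ a ⌋) (lem (𝟘 ≟ᴳ 𝟘))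
  where
  lem : (d : Dec (𝟘 {n} ≡ 𝟘)) → ⌊ d ⌋ ∨ ⌊ 𝟘 ≟ᴳ a ⌋ ≡ true
  lem (yes _) = refl
  lem (no ¬p) = ⊥-elim (¬p refl)

ε₀ : ∀ {n} → P₀ n
ε₀ {n} = mkP₀ (λ g → ⌊ g ≟ᴳ 𝟘 ⌋) (lem (𝟘 ≟ᴳ 𝟘))
  where
  lem : (d : Dec (𝟘 {n} ≡ 𝟘)) → ⌊ d ⌋ ≡ true
  lem (yes _) = refl
  lem (no ¬p) = ⊥-elim (¬p refl)

-- Automorphisms of the monoid P₀(C₂ⁿ), with P₀ taken up to extensional
-- equality of subsets: a well-defined bijective monoid homomorphism.
record IsAutomorphism {n : ℕ} (f : P₀ n → P₀ n) : Set where
  field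
    ≐-cong     : ∀ {X Y} → X ≐ Y → f X ≐ f Y
    injective  : ∀ {X Y} → f X ≐ f Y → X ≐ Y
    surjective : ∀ Y → Σ (P₀ n) (λ X → f X ≐ Y)
    hom        : ∀ X Y → f (X ⊕ Y) ≐ (f X ⊕ f Y)
    unit       : f ε₀ ≐ ε₀

TrivialPullback : ∀ {n} → (P₀ n → P₀ n) → Set
TrivialPullback {n} f = (a : C₂^ n) → f (pair0 a) ≐ pair0 a

-- An automorphism f with trivial pullback fixes every {0,a}, hence every sum of fixed
-- sets. Label the nonzero elements of C₂³ by their binary expansions 1, …, 7. A further
-- set X is pinned down by the equations f(X) + P = f(X + P) = X + P for fixed P with
-- X + P fixed, and by injectivity (f(X) is no other fixed set). These equations cannot
-- single out a 3-element set {0,a,b}, since inside ⟨a,b⟩ the three 3-element sets behave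
-- alike. But {0,1,2} + {0,c} = {0,5,6} + {0,c} for c = 4, 7, and this link between the
-- candidates for f{0,1,2} ⊆ ⟨1,2⟩ and f{0,5,6} ⊆ ⟨5,6⟩ forces f{0,1,2} = {0,1,2}. After
-- that the equations fix every set in turn; the order of these deductions is recorded
-- in a certificate that is checked by evaluation on an encoding of P₀(C₂³).

module Submission where

open import Defs
open import Agda.Builtin.FromNat using (Number; fromNat)
open import Algebra.Core using (Op₂)
open import Data.Bool using (Bool; true; false; _∧_; T)
import Data.Bool as Bool
open import Data.Bool.ListAction using (any; or)
open import Data.Bool.Properties using (T-∧; T-≡; ⇔→≡; not-involutive)
open import Data.Digit using (toNatDigits)
open import Data.Fin using (Fin; zero; suc; toℕ; #_)
open import Data.Fin.Subset.Properties using (anySubset?)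
open import Data.List using (List; []; _∷_; map; cartesianProduct)
open import Data.List.Properties using (map-cong)
import Data.List.Membership.DecPropositional as DecMembership
open import Data.List.Membership.Propositional using (_∈_; find; lose)
open import Data.List.Membership.Propositional.Properties
  using (∈-map⁺; ∈-++⁺ˡ; ∈-++⁺ʳ; ∈-cartesianProduct⁺)
open import Data.List.Relation.Unary.All as All using (All; _∷_; all?)
open import Data.List.Relation.Unary.All.Properties using (map⁺)
open import Data.List.Relation.Unary.Any using (here)
open import Data.List.Relation.Unary.Any.Properties using (any⁺; any⁻)
open import Data.Nat using (ℕ; _≡ᵇ_)
import Data.Nat as ℕ
import Data.Nat.Literals as ℕ
open import Data.Product using (_×_; _,_)
open import Data.Unit using (⊤; tt)
open import Data.Vec using (Vec; []; _∷_; tabulate; lookup)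
open import Data.Vec.Properties using (tabulate-cong; ≡-dec)
open import Function using (_∘_)
open import Function.Bundles using (Equivalence; _⇔_; mk⇔)
open import Function.Definitions using (Injective)
open import Level using (0ℓ)
open import Relation.Binary.Definitions using (DecidableEquality)
open import Relation.Binary.PropositionalEquality
  using (_≡_; refl; sym; trans; cong; cong₂; subst; module ≡-Reasoning)
open import Relation.Nullary using (Dec; yes; ¬?)
open import Relation.Nullary.Decidable
  using (⌊_⌋; toWitness; fromWitness; _×-dec_; _→-dec_; decidable-stable; map′)
open import Relation.Unary using (Pred; Decidable; Universal)

-- With fromNat in scope numerals are overloaded; ℕ keeps its usual ones.
instance
  natNumeral : Number ℕ
  natNumeral = ℕ.number

module FixedPointPropagation
  {A : Set} (_≟_ : DecidableEquality A) (_∙_ : Op₂ A)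
  (∀? : {P : Pred A 0ℓ} → Decidable P → Dec (Universal P))
  where

  open DecMembership _≟_ using (_∈?_)

  data Step : Set where
    product           : (a b c : A) → Step
    determined        : (x : A) (Ps : List A) → Step
    jointlyDetermined : (x : A) (Ps : List A) (x′ : A) (Ps′ : List A) (Qs : List A) → Step

  conclusion : Step → A
  conclusion (product _ _ c)               = c
  conclusion (determined x _)              = x
  conclusion (jointlyDetermined x _ _ _ _) = x

  Usable : List A → A → Pred A 0ℓ
  Usable known x P = P ∈ known × x ∙ P ∈ known

  Candidate : List A → A → List A → Pred A 0ℓ
  Candidate known x Ps y = All (λ P → y ∙ P ≡ x ∙ P) Ps × (y ∈ known → y ≡ x)

  Valid : List A → Step → Set
  Valid known (product a b c) = a ∈ known × b ∈ known × a ∙ b ≡ c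
  Valid known (determined x Ps) =
    All (Usable known x) Ps × (∀ y → Candidate known x Ps y → y ≡ x)
  Valid known (jointlyDetermined x Ps x′ Ps′ Qs) =
    All (Usable known x) Ps × All (Usable known x′) Ps′ ×
    All (λ Q → Q ∈ known × x ∙ Q ≡ x′ ∙ Q) Qs ×
    (∀ y → Candidate known x Ps y → ∀ y′ → Candidate known x′ Ps′ y′ →
       All (λ Q → y ∙ Q ≡ y′ ∙ Q) Qs → y ≡ x)

  extend : List A → List Step → List A
  extend known []       = known
  extend known (s ∷ ss) = extend (conclusion s ∷ known) ss

  Valid* : List A → List Step → Set
  Valid* known []       = ⊤
  Valid* known (s ∷ ss) = Valid known s × Valid* (conclusion s ∷ known) ss

  usable? : ∀ known x → Decidable (Usable known x)
  usable? known x P = P ∈? known ×-dec x ∙ P ∈? known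

  candidate? : ∀ known x Ps → Decidable (Candidate known x Ps)
  candidate? known x Ps y = all? (λ P → (y ∙ P) ≟ (x ∙ P)) Ps ×-dec (y ∈? known →-dec y ≟ x)

  valid? : ∀ known s → Dec (Valid known s)
  valid? known (product a b c) = a ∈? known ×-dec b ∈? known ×-dec (a ∙ b) ≟ c
  valid? known (determined x Ps) =
    all? (usable? known x) Ps ×-dec ∀? (λ y → candidate? known x Ps y →-dec y ≟ x)
  valid? known (jointlyDetermined x Ps x′ Ps′ Qs) =
    all? (usable? known x) Ps ×-dec all? (usable? known x′) Ps′ ×-dec
    all? (λ Q → Q ∈? known ×-dec (x ∙ Q) ≟ (x′ ∙ Q)) Qs ×-dec
    ∀? (λ y → candidate? known x Ps y →-dec ∀? λ y′ → candidate? known x′ Ps′ y′ →-dec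
                all? (λ Q → (y ∙ Q) ≟ (y′ ∙ Q)) Qs →-dec y ≟ x)

  valid*? : ∀ known ss → Dec (Valid* known ss)
  valid*? known []       = yes tt
  valid*? known (s ∷ ss) = valid? known s ×-dec valid*? (conclusion s ∷ known) ss

  module _ {φ : A → A} (φ-hom : ∀ x y → φ (x ∙ y) ≡ φ x ∙ φ y)
           (φ-injective : Injective _≡_ _≡_ φ) where

    Fixed : Pred A 0ℓ
    Fixed x = φ x ≡ x

    ∙-fixed : ∀ {a b} → Fixed a → Fixed b → Fixed (a ∙ b)
    ∙-fixed {a} {b} φa≡a φb≡b = trans (φ-hom a b) (cong₂ _∙_ φa≡a φb≡b)

    φ-∙-fixed : ∀ {x P} → Fixed P → φ (x ∙ P) ≡ φ x ∙ P
    φ-∙-fixed {x} {P} φP≡P = trans (φ-hom x P) (cong (φ x ∙_) φP≡P)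

    φ-candidate : ∀ {known x Ps} → All Fixed known → All (Usable known x) Ps →
                  Candidate known x Ps (φ x)
    φ-candidate {x = x} fixed usable = All.map agree usable , injectivity
      where
      agree : ∀ {P} → Usable _ x P → φ x ∙ P ≡ x ∙ P
      agree (P∈ , x∙P∈) = trans (sym (φ-∙-fixed (All.lookup fixed P∈))) (All.lookup fixed x∙P∈)
      injectivity : φ x ∈ _ → φ x ≡ x
      injectivity φx∈ = φ-injective (All.lookup fixed φx∈)

    valid⇒fixed : ∀ {known} s → All Fixed known → Valid known s → Fixed (conclusion s)
    valid⇒fixed (product a b c) fixed (a∈ , b∈ , refl) =
      ∙-fixed (All.lookup fixed a∈) (All.lookup fixed b∈)
    valid⇒fixed (determined x Ps) fixed (usable , unique) =
      unique (φ x) (φ-candidate fixed usable)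
    valid⇒fixed (jointlyDetermined x Ps x′ Ps′ Qs) fixed (usable , usable′ , linked , unique) =
      unique (φ x) (φ-candidate fixed usable) (φ x′) (φ-candidate fixed usable′)
             (All.map transport linked)
      where
      transport : ∀ {Q} → Q ∈ _ × x ∙ Q ≡ x′ ∙ Q → φ x ∙ Q ≡ φ x′ ∙ Q
      transport (Q∈ , x∙Q≡x′∙Q) = begin
        φ x ∙ _     ≡⟨ sym (φ-∙-fixed φQ≡Q) ⟩
        φ (x ∙ _)   ≡⟨ cong φ x∙Q≡x′∙Q ⟩
        φ (x′ ∙ _)  ≡⟨ φ-∙-fixed φQ≡Q ⟩
        φ x′ ∙ _    ∎
        where
        open ≡-Reasoning
        φQ≡Q = All.lookup fixed Q∈

    extend-fixed : ∀ {known} ss → All Fixed known → Valid* known ss → All Fixed (extend known ss)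
    extend-fixed []       fixed _              = fixed
    extend-fixed (s ∷ ss) fixed (valid , valid*) =
      extend-fixed ss (valid⇒fixed s fixed valid ∷ fixed) valid*

    all-fixed : ∀ {known} ss → All Fixed known → Valid* known ss →
                (∀ x → x ∈ extend known ss) → ∀ x → Fixed x
    all-fixed ss fixed valid* covers x = All.lookup (extend-fixed ss fixed valid*) (covers x)

allSubsets? : ∀ {n} {P : Pred (Vec Bool n) 0ℓ} → Decidable P → Dec (Universal P)
allSubsets? P? = map′ (λ ¬∃¬ v → decidable-stable (P? v) (λ ¬p → ¬∃¬ (v , ¬p)))
                      (λ ∀P (v , ¬p) → ¬p (∀P v))
                      (¬? (anySubset? (¬? ∘ P?)))

elems-complete : ∀ {n} (x : C₂^ n) → x ∈ elems n
elems-complete []          = here refl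
elems-complete (false ∷ x) = ∈-++⁺ˡ (∈-map⁺ (false ∷_) (elems-complete x))
elems-complete (true  ∷ x) = ∈-++⁺ʳ _ (∈-map⁺ (true ∷_) (elems-complete x))

⊞-cancelˡ : ∀ {n} (x z : C₂^ n) → x ⊞ (x ⊞ z) ≡ z
⊞-cancelˡ []          []      = refl
⊞-cancelˡ (false ∷ x) (c ∷ z) = cong (c ∷_) (⊞-cancelˡ x z)
⊞-cancelˡ (true  ∷ x) (c ∷ z) = cong₂ _∷_ (not-involutive c) (⊞-cancelˡ x z)

⊞-solve : ∀ {n} {x y z : C₂^ n} → x ⊞ y ≡ z → y ≡ x ⊞ z
⊞-solve {x = x} {y} refl = sym (⊞-cancelˡ x y)

T-injective : ∀ {a b} → T a ⇔ T b → a ≡ b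
T-injective Ta⇔Tb =
  ⇔→≡ {z = true} (mk⇔ (to T-≡ ∘ to Ta⇔Tb ∘ from T-≡) (to T-≡ ∘ from Ta⇔Tb ∘ from T-≡))
  where open Equivalence

-- The same sumset tested with |G| instead of |G|² summands:
-- z ∈ X + Y iff x + z ∈ Y for some x ∈ X.
_+ᶠ_ : ∀ {n} → Subset n → Subset n → Subset n
_+ᶠ_ {n} X Y z = any (λ x → X x ∧ Y (x ⊞ z)) (elems n)

+ˢ≗+ᶠ : ∀ {n} (X Y : Subset n) z → (X +ˢ Y) z ≡ (X +ᶠ Y) z
+ˢ≗+ᶠ {n} X Y z = T-injective (mk⇔ forth back)
  where
  open Equivalence
  G×G : List (C₂^ n × C₂^ n)
  G×G = cartesianProduct (elems n) (elems n)
  summand : C₂^ n × C₂^ n → Bool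
  summand (x , y) = X x ∧ Y y ∧ ⌊ (x ⊞ y) ≟ᴳ z ⌋

  forth : T (any summand G×G) → T ((X +ᶠ Y) z)
  forth z∈X+Y =
    let (x , y) , _ , holds = find (any⁻ summand G×G z∈X+Y)
        Xx , rest  = to (T-∧ {X x}) holds
        Yy , x⊞y≡z = to (T-∧ {Y y}) rest
        y≡x⊞z      = ⊞-solve (toWitness {a? = (x ⊞ y) ≟ᴳ z} x⊞y≡z)
    in any⁺ _ (lose (elems-complete x) (from (T-∧ {X x}) (Xx , subst (T ∘ Y) y≡x⊞z Yy)))

  back : T ((X +ᶠ Y) z) → T (any summand G×G)
  back z∈X+Y =
    let x , _ , holds = find (any⁻ _ (elems n) z∈X+Y)
        Xx , Yx⊞z   = to (T-∧ {X x}) holds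
        x⊞[x⊞z]≡z   = fromWitness {a? = (x ⊞ (x ⊞ z)) ≟ᴳ z} (⊞-cancelˡ x z)
        pair∈       = ∈-cartesianProduct⁺ (elems-complete x) (elems-complete (x ⊞ z))
    in any⁺ summand (lose pair∈
         (from (T-∧ {X x}) (Xx , from (T-∧ {Y (x ⊞ z)}) (Yx⊞z , x⊞[x⊞z]≡z))))

⊕-cong : ∀ {n} {X X′ Y Y′ : P₀ n} → X ≐ X′ → Y ≐ Y′ → (X ⊕ Y) ≐ (X′ ⊕ Y′)
⊕-cong {n} {X} {X′} {Y} {Y′} X≐X′ Y≐Y′ z =
  cong or (map-cong summand-cong (cartesianProduct (elems n) (elems n)))
  where
  summand-cong : ∀ ((x , y) : C₂^ n × C₂^ n) →
                 set X x ∧ set Y y ∧ ⌊ (x ⊞ y) ≟ᴳ z ⌋ ≡ set X′ x ∧ set Y′ y ∧ ⌊ (x ⊞ y) ≟ᴳ z ⌋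
  summand-cong (x , y) = cong₂ _∧_ (X≐X′ x) (cong₂ _∧_ (Y≐Y′ y) refl)

-- X ∈ P₀(C₂³) is encoded by the characteristic vector of X ∖ {0}; entry i records
-- the element with binary expansion i + 1.
Code : Set
Code = Vec Bool 7

element : Fin 7 → C₂^ 3
element zero                                     = false ∷ false ∷ true  ∷ []
element (suc zero)                               = false ∷ true  ∷ false ∷ []
element (suc (suc zero))                         = false ∷ true  ∷ true  ∷ []
element (suc (suc (suc zero)))                   = true  ∷ false ∷ false ∷ []
element (suc (suc (suc (suc zero))))             = true  ∷ false ∷ true  ∷ []
element (suc (suc (suc (suc (suc zero)))))       = true  ∷ true  ∷ false ∷ []
element (suc (suc (suc (suc (suc (suc zero)))))) = true  ∷ true  ∷ true  ∷ []

encode : P₀ 3 → Code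
encode X = tabulate (set X ∘ element)

decode : Code → P₀ 3
decode v = mkP₀ member refl
  where
  member : Subset 3
  member (false ∷ false ∷ false ∷ []) = true
  member (false ∷ false ∷ true  ∷ []) = lookup v (# 0)
  member (false ∷ true  ∷ false ∷ []) = lookup v (# 1)
  member (false ∷ true  ∷ true  ∷ []) = lookup v (# 2)
  member (true  ∷ false ∷ false ∷ []) = lookup v (# 3)
  member (true  ∷ false ∷ true  ∷ []) = lookup v (# 4)
  member (true  ∷ true  ∷ false ∷ []) = lookup v (# 5)
  member (true  ∷ true  ∷ true  ∷ []) = lookup v (# 6)

encode-decode : ∀ v → encode (decode v) ≡ v
encode-decode (_ ∷ _ ∷ _ ∷ _ ∷ _ ∷ _ ∷ _ ∷ []) = refl

decode-encode : ∀ X → decode (encode X) ≐ X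
decode-encode X (false ∷ false ∷ false ∷ []) = sym (has0 X)
decode-encode X (false ∷ false ∷ true  ∷ []) = refl
decode-encode X (false ∷ true  ∷ false ∷ []) = refl
decode-encode X (false ∷ true  ∷ true  ∷ []) = refl
decode-encode X (true  ∷ false ∷ false ∷ []) = refl
decode-encode X (true  ∷ false ∷ true  ∷ []) = refl
decode-encode X (true  ∷ true  ∷ false ∷ []) = refl
decode-encode X (true  ∷ true  ∷ true  ∷ []) = refl

encode-cong : ∀ {X Y} → X ≐ Y → encode X ≡ encode Y
encode-cong X≐Y = tabulate-cong (X≐Y ∘ element)

encode-injective : ∀ {X Y} → encode X ≡ encode Y → X ≐ Y
encode-injective {X} {Y} eq g =
  trans (sym (decode-encode X g)) (trans (cong (λ v → set (decode v) g) eq) (decode-encode Y g))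

_+ᶜ_ : Op₂ Code
u +ᶜ v = tabulate ((set (decode u) +ᶠ set (decode v)) ∘ element)

+ᶜ-correct : ∀ u v → u +ᶜ v ≡ encode (decode u ⊕ decode v)
+ᶜ-correct u v = tabulate-cong (λ i → sym (+ˢ≗+ᶠ (set (decode u)) (set (decode v)) (element i)))

encode-+ᶜ : ∀ X Y → encode X +ᶜ encode Y ≡ encode (X ⊕ Y)
encode-+ᶜ X Y = trans (+ᶜ-correct (encode X) (encode Y))
                      (encode-cong {decode (encode X) ⊕ decode (encode Y)} {X ⊕ Y}
                                   (⊕-cong {X = decode (encode X)} {X} {decode (encode Y)} {Y}
                                           (decode-encode X) (decode-encode Y)))

-- A numeral denotes {0} together with its decimal digits 1–7: 1246 is {0, 1, 2, 4, 6}.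
instance
  codeNumeral : Number Code
  codeNumeral = record
    { Constraint = λ _ → ⊤
    ; fromNat    = λ n → tabulate (λ i → any (_≡ᵇ ℕ.suc (toℕ i)) (toNatDigits 10 n))
    }

_≟ᶜ_ : DecidableEquality Code
_≟ᶜ_ = ≡-dec Bool._≟_

open FixedPointPropagation _≟ᶜ_ _+ᶜ_ allSubsets?
open DecMembership _≟ᶜ_ using (_∈?_)

pairs : List Code
pairs = map (encode ∘ pair0) (elems 3)

certificate : List Step
certificate =
    product 1 2 123
  ∷ product 5 6 356
  ∷ jointlyDetermined 12 (1 ∷ 2 ∷ []) 56 (5 ∷ 6 ∷ []) (4 ∷ 7 ∷ [])
  ∷ product 1 4 145
  ∷ product 1 6 167
  ∷ product 1 356 1234567
  ∷ product 2 4 246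
  ∷ product 2 5 257
  ∷ product 3 4 347
  ∷ product 4 12 12456
  ∷ determined 25 (2 ∷ 4 ∷ [])
  ∷ determined 16 (1 ∷ 4 ∷ [])
  ∷ determined 56 (3 ∷ 4 ∷ [])
  ∷ determined 1256 (1 ∷ 2 ∷ 4 ∷ [])
  ∷ product 1 25 12345
  ∷ determined 24 (1 ∷ 2 ∷ [])
  ∷ determined 34 (1 ∷ 3 ∷ [])
  ∷ determined 35 (1 ∷ 3 ∷ [])
  ∷ determined 36 (3 ∷ [])
  ∷ determined 1245 (1 ∷ 2 ∷ 4 ∷ [])
  ∷ determined 124 (1 ∷ 4 ∷ 7 ∷ [])
  ∷ determined 125 (1 ∷ 4 ∷ 6 ∷ [])
  ∷ determined 245 (1 ∷ 4 ∷ [])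
  ∷ determined 1456 (4 ∷ 6 ∷ [])
  ∷ determined 156 (2 ∷ 4 ∷ [])
  ∷ determined 1345 (1 ∷ 2 ∷ 6 ∷ [])
  ∷ determined 2345 (1 ∷ 3 ∷ [])
  ∷ determined 345 (1 ∷ 2 ∷ [])
  ∷ product 1 56 14567
  ∷ determined 46 (1 ∷ 2 ∷ [])
  ∷ determined 26 (2 ∷ [])
  ∷ determined 47 (1 ∷ 3 ∷ [])
  ∷ determined 37 (3 ∷ [])
  ∷ determined 57 (1 ∷ 2 ∷ [])
  ∷ determined 27 (2 ∷ [])
  ∷ determined 146 (1 ∷ 3 ∷ 4 ∷ [])
  ∷ determined 456 (1 ∷ 4 ∷ [])
  ∷ determined 1457 (1 ∷ 2 ∷ 6 ∷ [])
  ∷ determined 4567 (1 ∷ 7 ∷ [])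
  ∷ determined 457 (1 ∷ 6 ∷ [])
  ∷ product 1 36 12367
  ∷ determined 126 (1 ∷ 4 ∷ [])
  ∷ determined 2367 (1 ∷ 2 ∷ 6 ∷ [])
  ∷ product 2 16 12346
  ∷ determined 14 (1 ∷ 2 ∷ [])
  ∷ determined 1246 (2 ∷ 4 ∷ [])
  ∷ determined 2456 (3 ∷ 4 ∷ [])
  ∷ determined 256 (4 ∷ [])
  ∷ determined 1234 (1 ∷ 2 ∷ 4 ∷ [])
  ∷ determined 134 (1 ∷ 2 ∷ 6 ∷ [])
  ∷ determined 234 (1 ∷ 2 ∷ [])
  ∷ determined 1235 (1 ∷ 5 ∷ [])
  ∷ determined 135 (1 ∷ 7 ∷ [])
  ∷ determined 235 (1 ∷ [])
  ∷ determined 1236 (1 ∷ 2 ∷ 5 ∷ [])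
  ∷ determined 1346 (2 ∷ 6 ∷ [])
  ∷ determined 136 (2 ∷ 4 ∷ [])
  ∷ determined 236 (1 ∷ 2 ∷ [])
  ∷ determined 2346 (2 ∷ 3 ∷ [])
  ∷ determined 346 (2 ∷ [])
  ∷ determined 1237 (1 ∷ 7 ∷ [])
  ∷ determined 237 (1 ∷ 6 ∷ [])
  ∷ product 2 56 24567
  ∷ determined 45 (1 ∷ 2 ∷ [])
  ∷ determined 15 (1 ∷ [])
  ∷ determined 67 (1 ∷ 2 ∷ [])
  ∷ determined 17 (1 ∷ [])
  ∷ determined 267 (1 ∷ 2 ∷ [])
  ∷ determined 2467 (2 ∷ 7 ∷ [])
  ∷ determined 467 (2 ∷ 5 ∷ [])
  ∷ determined 567 (1 ∷ 2 ∷ [])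
  ∷ product 2 35 12357
  ∷ determined 157 (1 ∷ 2 ∷ [])
  ∷ determined 1357 (2 ∷ 7 ∷ [])
  ∷ determined 137 (2 ∷ 5 ∷ [])
  ∷ determined 127 (1 ∷ 2 ∷ [])
  ∷ product 3 25 12356
  ∷ product 3 24 12347
  ∷ determined 147 (1 ∷ 3 ∷ [])
  ∷ determined 247 (2 ∷ 3 ∷ [])
  ∷ determined 1247 (3 ∷ 4 ∷ [])
  ∷ product 3 345 34567
  ∷ determined 357 (2 ∷ 3 ∷ [])
  ∷ determined 367 (1 ∷ 3 ∷ [])
  ∷ product 4 35 13457
  ∷ determined 13 (1 ∷ 4 ∷ [])
  ∷ determined 23 (1 ∷ [])
  ∷ determined 1347 (3 ∷ 4 ∷ [])
  ∷ determined 2347 (3 ∷ [])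
  ∷ determined 3457 (4 ∷ [])
  ∷ determined 3467 (3 ∷ 5 ∷ [])
  ∷ product 4 36 23467
  ∷ product 5 12 12457
  ∷ determined 1257 (2 ∷ 5 ∷ [])
  ∷ determined 2357 (2 ∷ [])
  ∷ determined 2457 (5 ∷ [])
  ∷ determined 2567 (2 ∷ [])
  ∷ product 5 16 13456
  ∷ determined 1356 (3 ∷ 5 ∷ [])
  ∷ determined 2356 (3 ∷ [])
  ∷ determined 3456 (5 ∷ [])
  ∷ determined 3567 (3 ∷ [])
  ∷ product 5 26 23567
  ∷ product 6 12 12467
  ∷ determined 1267 (1 ∷ 6 ∷ [])
  ∷ determined 1367 (1 ∷ [])
  ∷ determined 1467 (6 ∷ [])
  ∷ determined 1567 (1 ∷ [])
  ∷ product 6 25 23456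
  ∷ product 6 156 13567
  ∷ product 7 12 12567
  ∷ product 7 24 23457
  ∷ product 7 36 13467
  ∷ product 12 25 123457
  ∷ product 12 16 123467
  ∷ product 12 56 124567
  ∷ product 12 24 123456
  ∷ product 12 37 123567
  ∷ product 25 56 234567
  ∷ determined 134567 (1 ∷ [])
  ∷ []

certificate-valid : Valid* pairs certificate
certificate-valid = toWitness {a? = valid*? pairs certificate} _

certificate-complete : ∀ v → v ∈ extend pairs certificate
certificate-complete = toWitness {a? = allSubsets? (_∈? extend pairs certificate)} _

module Induced {f : P₀ 3 → P₀ 3} (f-aut : IsAutomorphism f) where

  open IsAutomorphism f-aut

  φ : Code → Code
  φ = encode ∘ f ∘ decode

  f-decode-encode : ∀ X → encode (f (decode (encode X))) ≡ encode (f X)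
  f-decode-encode X =
    encode-cong {f (decode (encode X))} {f X} (≐-cong {decode (encode X)} {X} (decode-encode X))

  φ-hom : ∀ u v → φ (u +ᶜ v) ≡ φ u +ᶜ φ v
  φ-hom u v = begin
    φ (u +ᶜ v)                            ≡⟨ cong φ (+ᶜ-correct u v) ⟩
    φ (encode (decode u ⊕ decode v))      ≡⟨ f-decode-encode (decode u ⊕ decode v) ⟩
    encode (f (decode u ⊕ decode v))      ≡⟨ encode-cong {f (decode u ⊕ decode v)}
                                                         {f (decode u) ⊕ f (decode v)}
                                                         (hom (decode u) (decode v)) ⟩
    encode (f (decode u) ⊕ f (decode v))  ≡⟨ sym (encode-+ᶜ (f (decode u)) (f (decode v))) ⟩
    φ u +ᶜ φ v                            ∎
    where open ≡-Reasoning

  φ-injective : Injective _≡_ _≡_ φ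
  φ-injective {u} {v} φu≡φv = begin
    u                 ≡⟨ sym (encode-decode u) ⟩
    encode (decode u) ≡⟨ encode-cong {decode u} {decode v}
                           (injective (encode-injective {f (decode u)} {f (decode v)} φu≡φv)) ⟩
    encode (decode v) ≡⟨ encode-decode v ⟩
    v                 ∎
    where open ≡-Reasoning

  pairs-fixed : TrivialPullback f → All (λ v → φ v ≡ v) pairs
  pairs-fixed trivial = map⁺ (All.universal pair-fixed (elems 3))
    where
    pair-fixed : ∀ a → φ (encode (pair0 a)) ≡ encode (pair0 a)
    pair-fixed a =
      trans (f-decode-encode (pair0 a)) (encode-cong {f (pair0 a)} {pair0 a} (trivial a))

lemma3p5 : (f : P₀ 3 → P₀ 3) → IsAutomorphism f → TrivialPullback f → (X : P₀ 3) → f X ≐ X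
lemma3p5 f f-aut trivial X = encode-injective {f X} {X} (begin
  encode (f X)   ≡⟨ sym (f-decode-encode X) ⟩
  φ (encode X)   ≡⟨ every-code-fixed (encode X) ⟩
  encode X       ∎)
  where
  open ≡-Reasoning
  open Induced f-aut
  every-code-fixed : ∀ v → φ v ≡ v
  every-code-fixed = all-fixed φ-hom φ-injective certificate (pairs-fixed trivial)
                               certificate-valid certificate-complete
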